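{- The category $\mathcal{OS}$ does not have equalisers; that is, there exist a pair of parallel morphisms in $\mathcal{OS}$ that has no equaliser in $\mathcal{OS}$.
   Context: An orthoset (with $0$) is a non-empty set $X$ with a binary relation $\perp$ and a distinguished element $0$ such that: $x\perp y$ implies $y\perp x$; $x\perp x$ iff $x=0$; $0\perp x$ for all $x$. A map $f\colon X\to Y$ is adjointable if there is $g\colon Y\to X$ with $f(x)\perp y\iff x\perp g(y)$ for all $x,y$. $\mathcal{OS}$ is the category of all orthosets and adjointable maps. -}

module Defs where

open import Data.Product using (Σ; Σ-syntax; _×_; _,_; proj₁; proj₂)
open import Relation.Binary.PropositionalEquality using (_≡_)
open import Relation.Nullary using (¬_)
open import Function.Bundles using (_⇔_; mk⇔; Equivalence)

-- An orthoset (with 0): a set with a binary relation ⊥ and a distinguished 0,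
-- such that ⊥ is symmetric, x ⊥ x iff x = 0, and 0 ⊥ x for all x.
-- (Non-emptiness is automatic since 0 is an element.)
record Orthoset : Set₁ where
  field
    Carrier : Set
    _⊥_     : Carrier → Carrier → Set
    𝟘       : Carrier
    ⊥-sym   : ∀ {x y} → x ⊥ y → y ⊥ x
    ⊥-self  : ∀ x → (x ⊥ x) ⇔ (x ≡ 𝟘)
    𝟘-⊥     : ∀ x → 𝟘 ⊥ x

open Orthoset public

Adjointable : (X Y : Orthoset) → (Carrier X → Carrier Y) → Set
Adjointable X Y f =
  Σ[ g ∈ (Carrier Y → Carrier X) ] (∀ x y → (_⊥_ Y (f x) y) ⇔ (_⊥_ X x (g y)))

record Hom (X Y : Orthoset) : Set where
  constructor hom
  field
    map        : Carrier X → Carrier Y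
    adjointable : Adjointable X Y map

open Hom public

_≈_ : ∀ {X Y} → Hom X Y → Hom X Y → Set
f ≈ g = ∀ x → map f x ≡ map g x

_∘ₒ_ : ∀ {X Y Z} → Hom Y Z → Hom X Y → Hom X Z
_∘ₒ_ {X} {Y} {Z} (hom f (f* , pf)) (hom g (g* , pg)) =
  hom (λ x → f (g x))
      ((λ z → g* (f* z)) ,
       λ x z → mk⇔ (λ h → Equivalence.to (pg x (f* z)) (Equivalence.to (pf (g x) z) h))
                   (λ h → Equivalence.from (pf (g x) z) (Equivalence.from (pg x (f* z)) h)))

IsEqualiser : ∀ {X Y} (f g : Hom X Y) (E : Orthoset) (e : Hom E X) → Set₁
IsEqualiser {X} f g E e =
  ((f ∘ₒ e) ≈ (g ∘ₒ e)) ×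
  (∀ (Z : Orthoset) (h : Hom Z X) → (f ∘ₒ h) ≈ (g ∘ₒ h) →
     Σ[ u ∈ Hom Z E ] (((e ∘ₒ u) ≈ h) ×
        (∀ (u' : Hom Z E) → (e ∘ₒ u') ≈ h → u' ≈ u)))

HasEqualiser : ∀ {X Y} (f g : Hom X Y) → Set₁
HasEqualiser {X} f g = Σ[ E ∈ Orthoset ] Σ[ e ∈ Hom E X ] IsEqualiser f g E e

-- Take 𝕏 = {0, a₁, a₂, a₃} with a₂ ⊥ a₃ as the only non-trivial orthogonality, and let
-- f, g : 𝕏 → 𝟚 send x to 0 exactly when x ⊥ a₃, resp. x ⊥ a₁; they agree precisely on
-- {0, a₁, a₃}. An equaliser e : E → 𝕏 is injective and hits a₁ and a₃, and its image
-- avoids a₂. Adjointness forces e(e* a₂) = a₁ = e(e* a₁), so e* a₂ = e* a₁; but the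
-- preimage of a₃ is orthogonal to e* a₂ and not to e* a₁.
module Submission where

open import Data.Bool using (Bool; true; false; T)
open import Data.Empty renaming (⊥ to Empty) using (⊥-elim)
open import Data.Maybe using (Maybe; nothing; just)
open import Data.Product using (Σ; Σ-syntax; _,_; proj₁; proj₂)
open import Data.Unit using (⊤; tt)
open import Function.Bundles using (_⇔_; mk⇔; Equivalence)
open import Function.Construct.Composition using (_⇔-∘_)
open import Function.Construct.Symmetry using (⇔-sym)
open import Relation.Binary.Definitions as B using ()
open import Relation.Binary.PropositionalEquality using (_≡_; refl; sym; trans; subst)
open import Relation.Nullary using (¬_; yes; no)
open import Relation.Nullary.Decidable as Dec using (T?)
open import Relation.Unary as U using ()

open import Defs

open Equivalence using (to; from)

⊥-sym⇔ : (W : Orthoset) {x y : Carrier W} → _⊥_ W x y ⇔ _⊥_ W y x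
⊥-sym⇔ W = mk⇔ (⊥-sym W) (⊥-sym W)

⊥-𝟘 : (W : Orthoset) (x : Carrier W) → _⊥_ W x (𝟘 W)
⊥-𝟘 W x = ⊥-sym W (𝟘-⊥ W x)

adjoint : {X Y : Orthoset} → Hom X Y → Carrier Y → Carrier X
adjoint f = proj₁ (adjointable f)

adjunction : {X Y : Orthoset} (f : Hom X Y) (x : Carrier X) (y : Carrier Y) →
             _⊥_ Y (map f x) y ⇔ _⊥_ X x (adjoint f y)
adjunction f = proj₂ (adjointable f)

module _ {X Y : Orthoset} (f : Hom X Y) where

  dual : Hom Y X
  dual = hom (adjoint f) (map f , λ y x →
    ⊥-sym⇔ Y ⇔-∘ (⇔-sym (adjunction f x y) ⇔-∘ ⊥-sym⇔ X))

  map-𝟘 : map f (𝟘 X) ≡ 𝟘 Y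
  map-𝟘 = to (⊥-self Y _) (from (adjunction f (𝟘 X) _) (𝟘-⊥ X _))

  map-adjoint-⊥⇒map-⊥ : ∀ {y} → _⊥_ Y (map f (adjoint f y)) y → ∀ x → _⊥_ Y (map f x) y
  map-adjoint-⊥⇒map-⊥ {y} ff*y⊥y x = from (adjunction f x y) (subst (_⊥_ X x) (sym f*y≡𝟘) (⊥-𝟘 X x))
    where
    f*y≡𝟘 : adjoint f y ≡ 𝟘 X
    f*y≡𝟘 = to (⊥-self X _) (to (adjunction f (adjoint f y) y) ff*y⊥y)

  map-adjoint-⊥-sym : ∀ {y y′} → _⊥_ Y (map f (adjoint f y)) y′ → _⊥_ Y (map f (adjoint f y′)) y
  map-adjoint-⊥-sym {y} {y′} h =
    from (adjunction f _ y) (⊥-sym X (to (adjunction f (adjoint f y) y′) h))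

  adjoint-⊥-decidable : B.Decidable (_⊥_ Y) → ∀ y → U.Decidable (_⊥_ X (adjoint f y))
  adjoint-⊥-decidable _⊥?_ y x = Dec.map (⊥-sym⇔ X ⇔-∘ adjunction f x y) (map f x ⊥? y)

module GraphOrthoset {A : Set} (R : A → A → Set) where

  infix 4 _⊥⁺_
  _⊥⁺_ : Maybe A → Maybe A → Set
  nothing ⊥⁺ _       = ⊤
  just _  ⊥⁺ nothing = ⊤
  just a  ⊥⁺ just b  = R a b

  ⊥⁺-dec : B.Decidable R → B.Decidable _⊥⁺_
  ⊥⁺-dec R? nothing  _        = yes tt
  ⊥⁺-dec R? (just _) nothing  = yes tt
  ⊥⁺-dec R? (just a) (just b) = R? a b

open GraphOrthoset using (_⊥⁺_; ⊥⁺-dec)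

graphOrthoset : {A : Set} (R : A → A → Set) → B.Symmetric R → (∀ {a} → ¬ R a a) → Orthoset
graphOrthoset {A} R R-sym R-irrefl = record
  { Carrier = Maybe A
  ; _⊥_     = _⊥⁺_ R
  ; 𝟘       = nothing
  ; ⊥-sym   = λ {x} {y} → ⊥⁺-sym {x} {y}
  ; ⊥-self  = ⊥⁺-self
  ; 𝟘-⊥     = λ _ → tt
  }
  where
  ⊥⁺-sym : ∀ {x y} → _⊥⁺_ R x y → _⊥⁺_ R y x
  ⊥⁺-sym {nothing} {nothing} _ = tt
  ⊥⁺-sym {nothing} {just _}  _ = tt
  ⊥⁺-sym {just _}  {nothing} _ = tt
  ⊥⁺-sym {just _}  {just _}  r = R-sym r

  ⊥⁺-self : ∀ x → _⊥⁺_ R x x ⇔ (x ≡ nothing)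
  ⊥⁺-self nothing  = mk⇔ (λ _ → refl) (λ _ → tt)
  ⊥⁺-self (just a) = mk⇔ (λ r → ⊥-elim (R-irrefl r)) (λ ())

𝟚 : Orthoset
𝟚 = graphOrthoset {⊤} (λ _ _ → Empty) (λ ()) (λ ())

-- The adjoint of a point classifies w^⊥, so constructively w^⊥ must be decidable.
point : (W : Orthoset) (w : Carrier W) → U.Decidable (_⊥_ W w) → Hom 𝟚 W
point W w w⊥? = hom embed (classify , adjunction-point)
  where
  embed : Maybe ⊤ → Carrier W
  embed nothing  = 𝟘 W
  embed (just _) = w

  classify : Carrier W → Maybe ⊤
  classify t with w⊥? t
  ... | yes _ = nothing
  ... | no  _ = just tt

  adjunction-point : ∀ b t → _⊥_ W (embed b) t ⇔ _⊥_ 𝟚 b (classify t)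
  adjunction-point nothing  t = mk⇔ (λ _ → tt) (λ _ → 𝟘-⊥ W t)
  adjunction-point (just _) t with w⊥? t
  ... | yes w⊥t = mk⇔ (λ _ → tt) (λ _ → w⊥t)
  ... | no  w⊥̸t = mk⇔ w⊥̸t ⊥-elim

point-equalised : {X Y : Orthoset} (f g : Hom X Y) {x : Carrier X} (x⊥? : U.Decidable (_⊥_ X x)) →
                  map f x ≡ map g x → (f ∘ₒ point X x x⊥?) ≈ (g ∘ₒ point X x x⊥?)
point-equalised f g _ _     nothing  = trans (map-𝟘 f) (sym (map-𝟘 g))
point-equalised f g _ fx≡gx (just _) = fx≡gx

module Equaliser {X Y E : Orthoset} {f g : Hom X Y} {e : Hom E X} (isEq : IsEqualiser f g E e) where

  equaliser-monic : {Z : Orthoset} (u v : Hom Z E) → (e ∘ₒ u) ≈ (e ∘ₒ v) → u ≈ v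
  equaliser-monic u v eu≈ev z with proj₂ isEq _ (e ∘ₒ v) (λ z′ → proj₁ isEq (map v z′))
  ... | _ , _ , unique = trans (unique u eu≈ev z) (sym (unique v (λ _ → refl) z))

  equaliser-injective : ∀ {p p′} (p⊥? : U.Decidable (_⊥_ E p)) (p′⊥? : U.Decidable (_⊥_ E p′)) →
                        map e p ≡ map e p′ → p ≡ p′
  equaliser-injective p⊥? p′⊥? ep≡ep′ =
    equaliser-monic (point E _ p⊥?) (point E _ p′⊥?) same-image (just tt)
    where
    same-image : (e ∘ₒ point E _ p⊥?) ≈ (e ∘ₒ point E _ p′⊥?)
    same-image nothing  = refl
    same-image (just _) = ep≡ep′

  equaliser-lift : ∀ x → map f x ≡ map g x → U.Decidable (_⊥_ X x) → Σ[ p ∈ Carrier E ] map e p ≡ x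
  equaliser-lift x fx≡gx x⊥? with proj₂ isEq 𝟚 (point X x x⊥?) (point-equalised f g x⊥? fx≡gx)
  ... | u , eu≈point , _ = map u (just tt) , eu≈point (just tt)

data Atom : Set where
  a₁ a₂ a₃ : Atom

_∼ᵇ_ : Atom → Atom → Bool
a₂ ∼ᵇ a₃ = true
a₃ ∼ᵇ a₂ = true
_  ∼ᵇ _  = false

∼ᵇ-comm : ∀ a b → a ∼ᵇ b ≡ b ∼ᵇ a
∼ᵇ-comm a₁ a₁ = refl
∼ᵇ-comm a₁ a₂ = refl
∼ᵇ-comm a₁ a₃ = refl
∼ᵇ-comm a₂ a₁ = refl
∼ᵇ-comm a₂ a₂ = refl
∼ᵇ-comm a₂ a₃ = refl
∼ᵇ-comm a₃ a₁ = refl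
∼ᵇ-comm a₃ a₂ = refl
∼ᵇ-comm a₃ a₃ = refl

𝕏 : Orthoset
𝕏 = graphOrthoset (λ a b → T (a ∼ᵇ b)) (λ {a} {b} → subst T (∼ᵇ-comm a b))
                  (λ { {a₁} () ; {a₂} () ; {a₃} () })

𝕏-⊥? : B.Decidable (_⊥_ 𝕏)
𝕏-⊥? = ⊥⁺-dec _ (λ a b → T? (a ∼ᵇ b))

f g : Hom 𝕏 𝟚
f = dual (point 𝕏 (just a₃) (𝕏-⊥? (just a₃)))
g = dual (point 𝕏 (just a₁) (𝕏-⊥? (just a₁)))

equalised-¬⊥a₂⇒a₁ : ∀ x → map f x ≡ map g x → ¬ _⊥_ 𝕏 x (just a₂) → x ≡ just a₁
equalised-¬⊥a₂⇒a₁ nothing     _  x⊥̸a₂ = ⊥-elim (x⊥̸a₂ tt)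
equalised-¬⊥a₂⇒a₁ (just a₁)   _  _    = refl
equalised-¬⊥a₂⇒a₁ (just a₂)   () _
equalised-¬⊥a₂⇒a₁ (just a₃)   _  x⊥̸a₂ = ⊥-elim (x⊥̸a₂ tt)

no-equaliser : ¬ HasEqualiser f g
no-equaliser (E , e , isEq) = a₃⊥a₁
  where
  open Equaliser {f = f} {g = g} {e = e} isEq

  transport : ∀ {x x′} y → x ≡ x′ → _⊥_ 𝕏 x y → _⊥_ 𝕏 x′ y
  transport y = subst (λ x → _⊥_ 𝕏 x y)

  p₁ p₃ q r : Carrier E
  p₁ = proj₁ (equaliser-lift (just a₁) refl (𝕏-⊥? (just a₁)))
  p₃ = proj₁ (equaliser-lift (just a₃) refl (𝕏-⊥? (just a₃)))
  q  = adjoint e (just a₂)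
  r  = adjoint e (just a₁)

  e[p₁] : map e p₁ ≡ just a₁
  e[p₁] = proj₂ (equaliser-lift (just a₁) refl (𝕏-⊥? (just a₁)))

  e[p₃] : map e p₃ ≡ just a₃
  e[p₃] = proj₂ (equaliser-lift (just a₃) refl (𝕏-⊥? (just a₃)))

  e[q] : map e q ≡ just a₁
  e[q] = equalised-¬⊥a₂⇒a₁ _ (proj₁ isEq q) λ e[q]⊥a₂ →
    transport (just a₂) e[p₁] (map-adjoint-⊥⇒map-⊥ e e[q]⊥a₂ p₁)

  e[r] : map e r ≡ just a₁
  e[r] = equalised-¬⊥a₂⇒a₁ _ (proj₁ isEq r) λ e[r]⊥a₂ →
    transport (just a₁) e[q] (map-adjoint-⊥-sym e e[r]⊥a₂)

  q≡r : q ≡ r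
  q≡r = equaliser-injective (adjoint-⊥-decidable e 𝕏-⊥? _) (adjoint-⊥-decidable e 𝕏-⊥? _)
                            (trans e[q] (sym e[r]))

  p₃⊥q : _⊥_ E p₃ q
  p₃⊥q = to (adjunction e p₃ (just a₂)) (transport (just a₂) (sym e[p₃]) tt)

  a₃⊥a₁ : _⊥_ 𝕏 (just a₃) (just a₁)
  a₃⊥a₁ = transport (just a₁) e[p₃] (from (adjunction e p₃ (just a₁)) (subst (_⊥_ E p₃) q≡r p₃⊥q))

proposition5p7 : Σ[ X ∈ Orthoset ] Σ[ Y ∈ Orthoset ] Σ[ f ∈ Hom X Y ] Σ[ g ∈ Hom X Y ]
                   ¬ HasEqualiser f g
proposition5p7 = 𝕏 , 𝟚 , f , g , no-equaliser
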